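{- For every positive integer $t$ and every nonnegative integer $n$, $$S_{t+2}(n+1)=S_t(n+1)+4\,S_{t+2}(n).$$
   Context: For integers $n\ge 0$ and $t>0$, $S_t(n)=\sum_{i_1+\cdots+i_t=n}\binom{2i_1}{i_1}\binom{2i_2}{i_2}\cdots\binom{2i_t}{i_t}$, the sum ranging over all $t$-tuples of nonnegative integers $(i_1,\dots,i_t)$ with $i_1+\cdots+i_t=n$. -}

module Defs where

open import Data.Nat using (ℕ; zero; suc; _+_; _*_; _∸_)
open import Data.Nat.Combinatorics using (_C_)
open import Data.List using (List; []; _∷_; map; concatMap; upTo)
open import Data.Nat.ListAction using (sum)
open import Data.Vec using (Vec; []; _∷_)
open import Data.Vec as V using ()

centralBinom : ℕ → ℕ
centralBinom i = (2 * i) C i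

-- all t-tuples (i₁,…,iₜ) of nonnegative integers with i₁ + ⋯ + iₜ = n
-- (weak compositions of n into t parts), enumerated explicitly
tuples : (t : ℕ) → ℕ → List (Vec ℕ t)
tuples zero zero = [] ∷ []
tuples zero (suc n) = []
tuples (suc t) n = concatMap (λ i → map (i ∷_) (tuples t (n ∸ i))) (upTo (suc n))

prodCB : {t : ℕ} → Vec ℕ t → ℕ
prodCB v = V.foldr _ (λ i acc → centralBinom i * acc) 1 v

S : ℕ → ℕ → ℕ
S t n = sum (map prodCB (tuples t n))

-- Splitting off the first coordinate of a tuple shows that S_{t+1} is the
-- convolution c ⋆ S_t, and S_0 is the unit sequence (1, 0, 0, …).  The proof
-- rests on two facts about convolutions of sequences on ℕ:
--
--  * the self-convolution (c ⋆ c)(m) equals 4^m.  With the weighted sum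
--    W(m) = Σ i·c(i)·c(m-i), the symmetry i ↦ m-i gives 2W(m) = m·(c⋆c)(m),
--    while the recurrence (i+1)·c(i+1) = 2(2i+1)·c(i) gives
--    W(m+1) = 4W(m) + 2(c⋆c)(m); together (m+1)(c⋆c)(m+1) = 4(m+1)(c⋆c)(m);
--  * a recurrence g(n+1) = h(n+1) + a·g(n) with g(0) = h(0) is inherited by
--    f ⋆ g and f ⋆ h, for any sequence f.
--
-- The first fact is the case t = 0 of the recurrence (as S_0(n+1) = 0 and
-- S_2 = c ⋆ c); the second carries it from t to t+1.  The recurrence thus
-- holds for every t ≥ 0, in particular for t ≥ 1 as stated.
module Submission where

open import Defs
open import Data.Nat using (ℕ; zero; suc; _+_; _*_; _^_; _∸_; _≥_; _<_; z≤n; s≤s)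
open import Data.Nat.Properties
open import Data.Nat.Combinatorics
  using (_C_; nC1≡n; nCk≡nC[n∸k]; nCk+nC[k+1]≡[n+1]C[k+1])
open import Data.Nat.Tactic.RingSolver using (solve-∀)
open import Data.Nat.ListAction using (sum)
open import Data.Nat.ListAction.Properties using (sum-++)
open import Data.List using (List; []; _∷_; map; concatMap; applyUpTo; _++_)
open import Data.List.Properties using (map-++)
open import Data.Vec using (Vec; _∷_)
open import Function using (_∘_)
open import Relation.Binary.PropositionalEquality
open ≡-Reasoning

absorption : ∀ n k → suc k * (suc n C suc k) ≡ suc n * (n C k)
absorption zero    zero    = refl
absorption zero    (suc k) = *-zeroʳ (suc (suc k))
absorption (suc n) zero    = trans (*-identityˡ _) (trans (nC1≡n (suc (suc n))) (sym (*-identityʳ _)))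
absorption (suc n) (suc k) = begin
  suc (suc k) * (suc (suc n) C suc (suc k))
    ≡⟨ cong (suc (suc k) *_) (sym (nCk+nC[k+1]≡[n+1]C[k+1] (suc n) (suc k))) ⟩
  suc (suc k) * (B k + B (suc k))
    ≡⟨ *-distribˡ-+ (suc (suc k)) (B k) (B (suc k)) ⟩
  B k + suc k * B k + suc (suc k) * B (suc k)
    ≡⟨ cong₂ (λ x y → B k + x + y) (absorption n k) (absorption n (suc k)) ⟩
  B k + suc n * (n C k) + suc n * (n C suc k)
    ≡⟨ +-assoc (B k) _ _ ⟩
  B k + (suc n * (n C k) + suc n * (n C suc k))
    ≡⟨ cong (B k +_) (sym (*-distribˡ-+ (suc n) (n C k) (n C suc k))) ⟩
  B k + suc n * (n C k + n C suc k)
    ≡⟨ cong (λ x → B k + suc n * x) (nCk+nC[k+1]≡[n+1]C[k+1] n k) ⟩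
  suc (suc n) * B k ∎
  where
  B : ℕ → ℕ
  B j = suc n C suc j

-- The central binomial coefficients satisfy  (i+1)·c(i+1) = 2(2i+1)·c(i):
-- absorb once, use the symmetry binom(2i+1, i) = binom(2i+1, i+1), absorb again.
centralBinom-rec : ∀ i → suc i * centralBinom (suc i) ≡ 2 * (suc (2 * i) * centralBinom i)
centralBinom-rec i = begin
  suc i * (2 * suc i C suc i)           ≡⟨ cong (λ x → suc i * (x C suc i)) double-suc ⟩
  suc i * (suc (suc m) C suc i)         ≡⟨ absorption (suc m) i ⟩
  suc (suc m) * (suc m C i)             ≡⟨ cong₂ _*_ (sym double-suc) middle-symmetry ⟩
  2 * suc i * (suc m C suc i)           ≡⟨ *-assoc 2 (suc i) _ ⟩
  2 * (suc i * (suc m C suc i))         ≡⟨ cong (2 *_) (absorption m i) ⟩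
  2 * (suc m * centralBinom i)          ∎
  where
  m : ℕ
  m = 2 * i

  double-suc : 2 * suc i ≡ suc (suc m)
  double-suc = identity i
    where identity : ∀ i → 2 * suc i ≡ suc (suc (2 * i))
          identity = solve-∀

  middle-symmetry : suc m C i ≡ suc m C suc i
  middle-symmetry = begin
    suc m C i              ≡⟨ nCk≡nC[n∸k] (≤-trans (m≤m+n i (i + 0)) (n≤1+n m)) ⟩
    suc m C (suc m ∸ i)    ≡⟨ cong (λ x → suc m C (x ∸ i)) (identity i) ⟩
    suc m C (i + suc i ∸ i) ≡⟨ cong (suc m C_) (m+n∸m≡n i (suc i)) ⟩
    suc m C suc i          ∎
    where identity : ∀ i → suc (2 * i) ≡ i + suc i
          identity = solve-∀

Σ< : (ℕ → ℕ) → ℕ → ℕ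
Σ< f zero    = 0
Σ< f (suc n) = f 0 + Σ< (f ∘ suc) n

Σ<-cong : ∀ {f g} n → (∀ i → i < n → f i ≡ g i) → Σ< f n ≡ Σ< g n
Σ<-cong zero    eq = refl
Σ<-cong (suc n) eq = cong₂ _+_ (eq 0 (s≤s z≤n)) (Σ<-cong n (λ i i<n → eq (suc i) (s≤s i<n)))

Σ<-zero : ∀ n → Σ< (λ _ → 0) n ≡ 0
Σ<-zero zero    = refl
Σ<-zero (suc n) = Σ<-zero n

Σ<-distrib-+ : ∀ f g n → Σ< (λ i → f i + g i) n ≡ Σ< f n + Σ< g n
Σ<-distrib-+ f g zero    = refl
Σ<-distrib-+ f g (suc n) = begin
  f 0 + g 0 + Σ< (λ i → f (suc i) + g (suc i)) n ≡⟨ cong (f 0 + g 0 +_) (Σ<-distrib-+ (f ∘ suc) (g ∘ suc) n) ⟩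
  f 0 + g 0 + (Σ< (f ∘ suc) n + Σ< (g ∘ suc) n) ≡⟨ +-+-interchange (f 0) (g 0) _ _ ⟩
  f 0 + Σ< (f ∘ suc) n + (g 0 + Σ< (g ∘ suc) n) ∎
  where
  +-+-interchange : ∀ a b x y → a + b + (x + y) ≡ a + x + (b + y)
  +-+-interchange = solve-∀

Σ<-distribˡ-* : ∀ a f n → Σ< (λ i → a * f i) n ≡ a * Σ< f n
Σ<-distribˡ-* a f zero    = sym (*-zeroʳ a)
Σ<-distribˡ-* a f (suc n) =
  trans (cong (a * f 0 +_) (Σ<-distribˡ-* a (f ∘ suc) n)) (sym (*-distribˡ-+ a (f 0) _))

Σ<-snoc : ∀ f n → Σ< f (suc n) ≡ Σ< f n + f n
Σ<-snoc f zero    = +-comm (f 0) 0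
Σ<-snoc f (suc n) = trans (cong (f 0 +_) (Σ<-snoc (f ∘ suc) n)) (sym (+-assoc (f 0) _ _))

Σ<-reverse : ∀ f n → Σ< f n ≡ Σ< (λ i → f (n ∸ suc i)) n
Σ<-reverse f zero    = refl
Σ<-reverse f (suc n) = begin
  Σ< f (suc n)                          ≡⟨ Σ<-snoc f n ⟩
  Σ< f n + f n                          ≡⟨ cong (_+ f n) (Σ<-reverse f n) ⟩
  Σ< (λ i → f (n ∸ suc i)) n + f n      ≡⟨ +-comm _ (f n) ⟩
  f n + Σ< (λ i → f (n ∸ suc i)) n      ∎

conv : (ℕ → ℕ) → (ℕ → ℕ) → ℕ → ℕ
conv f g m = Σ< (λ i → f i * g (m ∸ i)) (suc m)

conv-congʳ : ∀ f {g h} m → (∀ k → g k ≡ h k) → conv f g m ≡ conv f h m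
conv-congʳ f m eq = Σ<-cong (suc m) (λ i _ → cong (f i *_) (eq (m ∸ i)))

conv-shift : ∀ f g m → conv f g (suc m) ≡ conv f (g ∘ suc) m + f (suc m) * g 0
conv-shift f g m = begin
  conv f g (suc m)
    ≡⟨ Σ<-snoc (λ i → f i * g (suc m ∸ i)) (suc m) ⟩
  Σ< (λ i → f i * g (suc m ∸ i)) (suc m) + f (suc m) * g (suc m ∸ suc m)
    ≡⟨ cong₂ _+_ (Σ<-cong (suc m) (λ i i≤m → cong (λ k → f i * g k) (+-∸-assoc 1 (≤-pred i≤m))))
                 (cong (λ k → f (suc m) * g k) (n∸n≡0 m)) ⟩
  conv f (g ∘ suc) m + f (suc m) * g 0 ∎

conv-linearʳ : ∀ a f g h m → conv f (λ k → g k + a * h k) m ≡ conv f g m + a * conv f h m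
conv-linearʳ a f g h m = begin
  conv f (λ k → g k + a * h k) m
    ≡⟨ Σ<-cong (suc m) (λ i _ → distribute (f i) (g (m ∸ i)) (h (m ∸ i))) ⟩
  Σ< (λ i → f i * g (m ∸ i) + a * (f i * h (m ∸ i))) (suc m)
    ≡⟨ Σ<-distrib-+ (λ i → f i * g (m ∸ i)) (λ i → a * (f i * h (m ∸ i))) (suc m) ⟩
  conv f g m + Σ< (λ i → a * (f i * h (m ∸ i))) (suc m)
    ≡⟨ cong (conv f g m +_) (Σ<-distribˡ-* a (λ i → f i * h (m ∸ i)) (suc m)) ⟩
  conv f g m + a * conv f h m ∎
  where
  distribute : ∀ x y z → x * (y + a * z) ≡ x * y + a * (x * z)
  distribute x y z = identity a x y z
    where identity : ∀ a x y z → x * (y + a * z) ≡ x * y + a * (x * z)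
          identity = solve-∀

conv-identityʳ : ∀ f g → g 0 ≡ 1 → (∀ k → g (suc k) ≡ 0) → ∀ m → conv f g m ≡ f m
conv-identityʳ f g g0≡1 gs≡0 zero    = trans (cong (λ x → f 0 * x + 0) g0≡1) (trans (+-identityʳ _) (*-identityʳ (f 0)))
conv-identityʳ f g g0≡1 gs≡0 (suc m) = begin
  conv f g (suc m)                      ≡⟨ conv-shift f g m ⟩
  conv f (g ∘ suc) m + f (suc m) * g 0  ≡⟨ cong₂ _+_ (trans (conv-congʳ f m gs≡0) vanishes) (cong (f (suc m) *_) g0≡1) ⟩
  f (suc m) * 1                         ≡⟨ *-identityʳ (f (suc m)) ⟩
  f (suc m)                             ∎
  where
  vanishes : conv f (λ _ → 0) m ≡ 0
  vanishes = trans (Σ<-cong (suc m) (λ i _ → *-zeroʳ (f i))) (Σ<-zero (suc m))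

conv-preserves-recurrence : ∀ a f g h → g 0 ≡ h 0 → (∀ n → g (suc n) ≡ h (suc n) + a * g n) →
  ∀ n → conv f g (suc n) ≡ conv f h (suc n) + a * conv f g n
conv-preserves-recurrence a f g h g0≡h0 rec n = begin
  conv f g (suc n)
    ≡⟨ conv-shift f g n ⟩
  conv f (g ∘ suc) n + f (suc n) * g 0
    ≡⟨ cong₂ _+_ (conv-congʳ f n rec) (cong (f (suc n) *_) g0≡h0) ⟩
  conv f (λ k → h (suc k) + a * g k) n + f (suc n) * h 0
    ≡⟨ cong (_+ f (suc n) * h 0) (conv-linearʳ a f (h ∘ suc) g n) ⟩
  conv f (h ∘ suc) n + a * conv f g n + f (suc n) * h 0
    ≡⟨ +-right-comm (conv f (h ∘ suc) n) (a * conv f g n) (f (suc n) * h 0) ⟩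
  conv f (h ∘ suc) n + f (suc n) * h 0 + a * conv f g n
    ≡⟨ cong (_+ a * conv f g n) (sym (conv-shift f h n)) ⟩
  conv f h (suc n) + a * conv f g n ∎
  where
  +-right-comm : ∀ x y z → x + y + z ≡ x + z + y
  +-right-comm = solve-∀

weightedConv : (ℕ → ℕ) → ℕ → ℕ
weightedConv f m = Σ< (λ i → i * (f i * f (m ∸ i))) (suc m)

-- Pairing the term i with the term m-i:  2·W_f(m) = m·(f ⋆ f)(m).
weightedConv-symmetry : ∀ f m → weightedConv f m + weightedConv f m ≡ m * conv f f m
weightedConv-symmetry f m = begin
  weightedConv f m + weightedConv f m
    ≡⟨ cong (weightedConv f m +_) (trans (Σ<-reverse weighted (suc m)) (Σ<-cong (suc m) reflect)) ⟩
  weightedConv f m + Σ< (λ i → (m ∸ i) * term i) (suc m)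
    ≡⟨ sym (Σ<-distrib-+ (λ i → i * term i) (λ i → (m ∸ i) * term i) (suc m)) ⟩
  Σ< (λ i → i * term i + (m ∸ i) * term i) (suc m)
    ≡⟨ Σ<-cong (suc m) (λ i i≤m → trans (sym (*-distribʳ-+ (term i) i (m ∸ i)))
                                         (cong (_* term i) (m+[n∸m]≡n (≤-pred i≤m)))) ⟩
  Σ< (λ i → m * term i) (suc m)
    ≡⟨ Σ<-distribˡ-* m term (suc m) ⟩
  m * conv f f m ∎
  where
  term weighted : ℕ → ℕ
  term i = f i * f (m ∸ i)
  weighted i = i * term i

  reflect : ∀ i → i < suc m → weighted (m ∸ i) ≡ (m ∸ i) * term i
  reflect i i≤m = cong ((m ∸ i) *_) (begin
    f (m ∸ i) * f (m ∸ (m ∸ i))  ≡⟨ cong (λ k → f (m ∸ i) * f k) (m∸[m∸n]≡n (≤-pred i≤m)) ⟩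
    f (m ∸ i) * f i              ≡⟨ *-comm (f (m ∸ i)) (f i) ⟩
    term i                       ∎)

-- From  (i+1)·c(i+1) = 2(2i+1)·c(i):  W_c(m+1) = 4·W_c(m) + 2·(c ⋆ c)(m).
weightedConv-centralBinom-step : ∀ m →
  weightedConv centralBinom (suc m) ≡ 4 * weightedConv centralBinom m + 2 * conv centralBinom centralBinom m
weightedConv-centralBinom-step m = begin
  Σ< (λ i → suc i * (c (suc i) * c (m ∸ i))) (suc m)
    ≡⟨ Σ<-cong (suc m) (λ i _ → expand i) ⟩
  Σ< (λ i → 4 * (i * term i) + 2 * term i) (suc m)
    ≡⟨ Σ<-distrib-+ (λ i → 4 * (i * term i)) (λ i → 2 * term i) (suc m) ⟩
  Σ< (λ i → 4 * (i * term i)) (suc m) + Σ< (λ i → 2 * term i) (suc m)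
    ≡⟨ cong₂ _+_ (Σ<-distribˡ-* 4 (λ i → i * term i) (suc m)) (Σ<-distribˡ-* 2 term (suc m)) ⟩
  4 * weightedConv c m + 2 * conv c c m ∎
  where
  c term : ℕ → ℕ
  c = centralBinom
  term i = c i * c (m ∸ i)

  expand : ∀ i → suc i * (c (suc i) * c (m ∸ i)) ≡ 4 * (i * term i) + 2 * term i
  expand i = begin
    suc i * (c (suc i) * c (m ∸ i))          ≡⟨ sym (*-assoc (suc i) (c (suc i)) _) ⟩
    suc i * c (suc i) * c (m ∸ i)            ≡⟨ cong (_* c (m ∸ i)) (centralBinom-rec i) ⟩
    2 * (suc (2 * i) * c i) * c (m ∸ i)      ≡⟨ identity i (c i) (c (m ∸ i)) ⟩
    4 * (i * term i) + 2 * term i            ∎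
    where identity : ∀ i x y → 2 * (suc (2 * i) * x) * y ≡ 4 * (i * (x * y)) + 2 * (x * y)
          identity = solve-∀

-- Σ_{i ≤ m} binom(2i,i)·binom(2(m-i),m-i) = 4^m.  Multiplying by m+1, the two
-- facts above give (m+1)·(c⋆c)(m+1) = (m+1)·4·(c⋆c)(m); cancel m+1.
centralBinom-selfConv : ∀ m → conv centralBinom centralBinom m ≡ 4 ^ m
centralBinom-selfConv zero    = refl
centralBinom-selfConv (suc m) = begin
  F (suc m)     ≡⟨ *-cancelˡ-≡ (F (suc m)) (4 * F m) (suc m) scaled ⟩
  4 * F m       ≡⟨ cong (4 *_) (centralBinom-selfConv m) ⟩
  4 * 4 ^ m     ∎
  where
  F W : ℕ → ℕ
  F = conv centralBinom centralBinom
  W = weightedConv centralBinom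

  scaled : suc m * F (suc m) ≡ suc m * (4 * F m)
  scaled = begin
    suc m * F (suc m)                ≡⟨ sym (weightedConv-symmetry centralBinom (suc m)) ⟩
    W (suc m) + W (suc m)            ≡⟨ cong₂ _+_ (weightedConv-centralBinom-step m) (weightedConv-centralBinom-step m) ⟩
    (4 * W m + 2 * F m) + (4 * W m + 2 * F m) ≡⟨ regroup (W m) (F m) ⟩
    4 * (W m + W m) + 4 * F m        ≡⟨ cong (λ x → 4 * x + 4 * F m) (weightedConv-symmetry centralBinom m) ⟩
    4 * (m * F m) + 4 * F m          ≡⟨ factor m (F m) ⟩
    suc m * (4 * F m)                ∎
    where
    regroup : ∀ w f → (4 * w + 2 * f) + (4 * w + 2 * f) ≡ 4 * (w + w) + 4 * f
    regroup = solve-∀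
    factor : ∀ m f → 4 * (m * f) + 4 * f ≡ suc m * (4 * f)
    factor = solve-∀

sum-concatMap : ∀ {X Y : Set} (g : Y → ℕ) (G : X → List Y) (xs : List X) →
  sum (map g (concatMap G xs)) ≡ sum (map (λ x → sum (map g (G x))) xs)
sum-concatMap g G []       = refl
sum-concatMap g G (x ∷ xs) = begin
  sum (map g (G x ++ concatMap G xs))               ≡⟨ cong sum (map-++ g (G x) (concatMap G xs)) ⟩
  sum (map g (G x) ++ map g (concatMap G xs))       ≡⟨ sum-++ (map g (G x)) _ ⟩
  sum (map g (G x)) + sum (map g (concatMap G xs))  ≡⟨ cong (sum (map g (G x)) +_) (sum-concatMap g G xs) ⟩
  sum (map g (G x)) + sum (map (λ x → sum (map g (G x))) xs) ∎

sum-applyUpTo : ∀ (g f : ℕ → ℕ) n → sum (map g (applyUpTo f n)) ≡ Σ< (g ∘ f) n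
sum-applyUpTo g f zero    = refl
sum-applyUpTo g f (suc n) = cong (g (f 0) +_) (sum-applyUpTo g (f ∘ suc) n)

sum-prodCB-cons : ∀ {t} i (vs : List (Vec ℕ t)) →
  sum (map prodCB (map (i ∷_) vs)) ≡ centralBinom i * sum (map prodCB vs)
sum-prodCB-cons i []       = sym (*-zeroʳ (centralBinom i))
sum-prodCB-cons i (v ∷ vs) =
  trans (cong (centralBinom i * prodCB v +_) (sum-prodCB-cons i vs))
        (sym (*-distribˡ-+ (centralBinom i) (prodCB v) _))

S-suc : ∀ t n → S (suc t) n ≡ conv centralBinom (S t) n
S-suc t n = begin
  S (suc t) n
    ≡⟨ sum-concatMap prodCB (λ i → map (i ∷_) (tuples t (n ∸ i))) (applyUpTo (λ i → i) (suc n)) ⟩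
  sum (map (λ i → sum (map prodCB (map (i ∷_) (tuples t (n ∸ i))))) (applyUpTo (λ i → i) (suc n)))
    ≡⟨ sum-applyUpTo (λ i → sum (map prodCB (map (i ∷_) (tuples t (n ∸ i))))) (λ i → i) (suc n) ⟩
  Σ< (λ i → sum (map prodCB (map (i ∷_) (tuples t (n ∸ i))))) (suc n)
    ≡⟨ Σ<-cong (suc n) (λ i _ → sum-prodCB-cons i (tuples t (n ∸ i))) ⟩
  conv centralBinom (S t) n ∎

-- Only the zero tuple sums to 0.
S-zero : ∀ t → S t 0 ≡ 1
S-zero zero    = refl
S-zero (suc t) = trans (S-suc t 0) (trans (+-identityʳ _) (trans (*-identityˡ _) (S-zero t)))

-- S_2(m) = 4^m, since S_2 = c ⋆ (c ⋆ S_0) and S_0 is the convolution unit.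
S-two : ∀ m → S 2 m ≡ 4 ^ m
S-two m = begin
  S 2 m                                    ≡⟨ S-suc 1 m ⟩
  conv centralBinom (S 1) m                ≡⟨ conv-congʳ centralBinom m S-one ⟩
  conv centralBinom centralBinom m         ≡⟨ centralBinom-selfConv m ⟩
  4 ^ m                                    ∎
  where
  S-one : ∀ k → S 1 k ≡ centralBinom k
  S-one k = trans (S-suc 0 k) (conv-identityʳ centralBinom (S 0) refl (λ _ → refl) k)

-- S_{t+2}(n+1) = S_t(n+1) + 4·S_{t+2}(n) for every t ≥ 0: for t = 0 it is
-- S_2(n+1) = 4·S_2(n), and convolving with c passes from t to t+1.
S-recurrence : ∀ t n → S (suc (suc t)) (suc n) ≡ S t (suc n) + 4 * S (suc (suc t)) n
S-recurrence zero    n = begin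
  S 2 (suc n)       ≡⟨ S-two (suc n) ⟩
  4 * 4 ^ n         ≡⟨ cong (4 *_) (sym (S-two n)) ⟩
  4 * S 2 n         ∎
S-recurrence (suc t) n = begin
  S (3 + t) (suc n)
    ≡⟨ S-suc (2 + t) (suc n) ⟩
  conv centralBinom (S (2 + t)) (suc n)
    ≡⟨ conv-preserves-recurrence 4 centralBinom (S (2 + t)) (S t)
         (trans (S-zero (2 + t)) (sym (S-zero t))) (S-recurrence t) n ⟩
  conv centralBinom (S t) (suc n) + 4 * conv centralBinom (S (2 + t)) n
    ≡⟨ sym (cong₂ (λ x y → x + 4 * y) (S-suc t (suc n)) (S-suc (2 + t) n)) ⟩
  S (suc t) (suc n) + 4 * S (3 + t) n ∎

lemma3p1 : (t n : ℕ) → t ≥ 1 → S (t + 2) (suc n) ≡ S t (suc n) + 4 * S (t + 2) n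
lemma3p1 t n _ rewrite +-comm t 2 = S-recurrence t n
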